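{- Let $K$ be a real quadratic field, with notation as below. Then: (1) for every positive integer $f$, $\mathcal{U}^+_f=\{\pm\varepsilon_f^{\,n} : n\in\mathbb{Z}\}$; (2) for every positive integer $k$, $j_{\min}(f_k)=k$; (3) for all positive integers $f,j$: $f\mid f_j$ if and only if $j_{\min}(f)\mid j$; (4) for all positive integers $j,k$: $j\mid k$ if and only if $f_j\mid f_k$.
   Context: Let $K\subset\mathbb{R}$ be a real quadratic field of discriminant $\Delta_0$, and let $\varepsilon$ be the smallest unit of $K$ of norm $+1$ that is greater than $1$. For positive integers $j$ set $f_j=(\varepsilon^j-\varepsilon^{ -j})/\sqrt{\Delta_0}$ (an integer). For a positive integer $f$, $\mathcal{O}_f=\{m+nf\frac{\Delta_0+\sqrt{\Delta_0}}{2}: m,n\in\mathbb{Z}\}$ is the order of conductor $f$ in $K$, and $\mathcal{U}^+_f=\{w\in\mathcal{O}_f:\operatorname{Nm}(w)=1\}$ is its group of norm-$1$ units. For each positive integer $f$ there exists $j$ with $f\mid f_j$; define $j_{\min}(f)=\min\{j\ge1: f\mid f_j\}$ and $\varepsilon_f=\varepsilon^{j_{\min}(f)}$. -}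

module Defs where

open import Data.Nat as ℕ using (ℕ; zero; suc)
import Data.Nat.Divisibility as ℕD
open import Data.Nat.DivMod using (_/_; _%_)
open import Data.Integer as ℤ using (ℤ; +_; -[1+_]; _+_; _*_; -_; _-_; _<_; _≤_)
open import Data.Integer.Divisibility using () renaming (_∣_ to _∣ℤ_)
open import Data.Product using (Σ; _×_; _,_; proj₁; proj₂)
open import Data.Sum using (_⊎_)
open import Relation.Binary.PropositionalEquality using (_≡_)

SqFree : ℕ → Set
SqFree n = ∀ p → (p ℕ.* p) ℕD.∣ n → p ≡ 1

FundDisc : ℕ → Set
FundDisc D = (D % 4 ≡ 1 × SqFree D)
           ⊎ Σ ℕ (λ m → D ≡ 4 ℕ.* m × (m % 4 ≡ 2 ⊎ m % 4 ≡ 3) × SqFree m)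

-- An element of the maximal order O_K, written  a + b·ω,
-- ω = (Δ₀ + √Δ₀)/2, as the pair (a , b).
Elt : Set
Elt = ℤ × ℤ

-- ω·ω' = (Δ₀² − Δ₀)/4,  ω + ω' = Δ₀, so ω² = Δ₀ ω − C.
Cst : ℕ → ℤ
Cst D = + ((D ℕ.* D ℕ.∸ D) / 4)

mul : ℕ → Elt → Elt → Elt
mul D (a , b) (c , d) = (a * c - b * d * Cst D , a * d + b * c + b * d * + D)

one : Elt
one = (+ 1 , + 0)

neg : Elt → Elt
neg (a , b) = (- a , - b)

sub : Elt → Elt → Elt
sub (a , b) (c , d) = (a - c , b - d)

-- Galois conjugate: ω ↦ ω' = Δ₀ − ω.
conj : ℕ → Elt → Elt
conj D (a , b) = (a + b * + D , - b)

-- Norm  Nm(a + bω) = (a + bω)(a + bω') = a² + ab Δ₀ + b² (Δ₀² − Δ₀)/4.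
Nm : ℕ → Elt → ℤ
Nm D (a , b) = a * a + a * b * + D + b * b * Cst D

pow : ℕ → Elt → ℕ → Elt
pow D x zero = one
pow D x (suc n) = mul D x (pow D x n)

-- Integer powers of a norm-1 unit (whose inverse is its conjugate).
zpow : ℕ → Elt → ℤ → Elt
zpow D x (+ n) = pow D x n
zpow D x -[1+ n ] = pow D (conj D x) (suc n)

-- Real embedding: a + bω = (u + v√Δ₀)/2 with u = 2a + bΔ₀, v = b.
-- PosUV D u v  ⇔  u + v√D > 0 (as a real number), decided by integer arithmetic.
PosUV : ℕ → ℤ → ℤ → Set
PosUV D u v =
    (+ 0 ≤ u × + 0 ≤ v × (+ 0 < u ⊎ + 0 < v))
  ⊎ (+ 0 < u × v < + 0 × + D * v * v < u * u)
  ⊎ (u < + 0 × + 0 < v × u * u < + D * v * v)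

Pos : ℕ → Elt → Set
Pos D (a , b) = PosUV D (+ 2 * a + b * + D) b

Gt : ℕ → Elt → Elt → Set
Gt D x y = Pos D (sub x y)

Ge : ℕ → Elt → Elt → Set
Ge D x y = Gt D x y ⊎ x ≡ y

IsFundUnit : ℕ → Elt → Set
IsFundUnit D ε = Nm D ε ≡ + 1 × Gt D ε one
  × (∀ u → Nm D u ≡ + 1 → Gt D u one → Ge D u ε)

-- Membership in the order of conductor f:  m + n f ω.
InOrder : ℕ → Elt → Set
InOrder f (a , b) = + f ∣ℤ b

-- f_j = (ε^j − ε^{-j})/√Δ₀.  Writing ε^j = a + bω, ε^{-j} = conj = a + bΔ₀ − bω,
-- so ε^j − ε^{-j} = b(2ω − Δ₀) = b√Δ₀, i.e. f_j is the ω-coordinate of ε^j.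
fj : ℕ → Elt → ℕ → ℤ
fj D ε j = proj₂ (pow D ε j)

IsJmin : ℕ → Elt → ℕ → ℕ → Set
IsJmin D ε f j = 1 ℕ.≤ j × (+ f ∣ℤ fj D ε j)
  × (∀ i → 1 ℕ.≤ i → + f ∣ℤ fj D ε i → j ℕ.≤ i)

module Submission where

open import Defs
open import Data.Nat as ℕ using (ℕ; zero; suc; z≤n; s≤s; _∸_)
import Data.Nat.Properties as ℕ
open import Data.Nat.Divisibility as ℕD using (divides; _∣0; m%n≡0⇒n∣m) renaming (_∣_ to _∣ℕ_)
open import Data.Nat.DivMod using (_/_; _%_; m≡m%n+[m/n]*n; m%n<n; m*[n/m]≡n)
open import Data.Nat.Induction using (<-rec)
open import Data.Integer as ℤ using (ℤ; +_; -[1+_]; _+_; _*_; -_; _-_; _⊖_; _≤_; _<_; +≤+; +<+; ∣_∣)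
import Data.Integer.Properties as ℤ
open import Data.Integer.Divisibility using () renaming (_∣_ to _∣ℤ_)
open import Data.Integer.Divisibility.Signed using (∣ᵤ⇒∣; ∣⇒∣ᵤ; ∣m∣n⇒∣m+n; ∣n⇒∣m*n; ∣m⇒∣m*n)
open import Data.Integer.Tactic.RingSolver using (solve; solve-∀)
open import Data.List using (_∷_; [])
open import Data.Product using (Σ; _×_; _,_; proj₁; proj₂; map; map₂; uncurry)
open import Data.Sum using (_⊎_; inj₁; inj₂; [_,_]′)
open import Data.Empty using (⊥-elim)
open import Function.Base using (id; _∘_)
open import Function.Bundles using (_⇔_; mk⇔)
open import Relation.Nullary using (yes; no; ¬_)
open import Relation.Binary.Definitions using (tri<; tri≈; tri>)
open import Relation.Binary.PropositionalEquality
open ≡-Reasoning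

-- Write x = a + bω as (u + v√Δ₀)/2 with u = tr x = 2a + bΔ₀ and v = b; then Nm x = 1 says
-- u² − Δ₀v² = 4, and a norm-one x exceeds 1 exactly when u > 0 and v > 0.  For such x,
-- minimality of ε gives v ≥ v(ε), and then x/ε = x·ε' still has u > 0 and 0 ≤ v, with v
-- strictly smaller; descent on v shows that x is a power of ε.  Conjugation (v ↦ −v) and
-- negation (u ↦ −u) reduce every norm-one unit to this case, so the norm-one units are ±ε^n.
-- Multiplying by ε increases v, so f_j = v(ε^j) is strictly increasing in j.  Finally
-- ε^j ∈ O_f exactly when f ∣ f_j, and the exponents j with ε^j ∈ O_f are closed under
-- subtraction, hence are the multiples of j_min(f); parts (1)–(4) follow.

-- An inequality between polynomials is proved by identifying, with the ring solver, the
-- difference of its sides with a sum of products of quantities already known to be nonnegative.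

0≤+ : ∀ n → + 0 ≤ + n
0≤+ n = +≤+ z≤n

0<+ : ∀ n → + 0 < + suc n
0<+ n = +<+ (s≤s z≤n)

0≤-+ : ∀ {i j} → + 0 ≤ i → + 0 ≤ j → + 0 ≤ i + j
0≤-+ = ℤ.+-mono-≤

0<-+ : ∀ {i j} → + 0 ≤ i → + 0 < j → + 0 < i + j
0<-+ = ℤ.+-mono-≤-<

0<-+ˡ : ∀ {i j} → + 0 < i → + 0 ≤ j → + 0 < i + j
0<-+ˡ = ℤ.+-mono-<-≤

0≤-* : ∀ {i j} → + 0 ≤ i → + 0 ≤ j → + 0 ≤ i * j
0≤-* {+ m} {+ n} _ _ = subst (+ 0 ≤_) (ℤ.pos-* m n) (0≤+ (m ℕ.* n))

0<-* : ∀ {i j} → + 0 < i → + 0 < j → + 0 < i * j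
0<-* (+<+ (s≤s z≤n)) (+<+ (s≤s z≤n)) = 0<+ _

0≤-sq : ∀ i → + 0 ≤ i * i
0≤-sq (+ n)    = 0≤-* (0≤+ n) (0≤+ n)
0≤-sq -[1+ n ] = 0≤+ _

0≤-gap : ∀ {i j} → i ≤ j → + 0 ≤ j - i
0≤-gap = ℤ.i≤j⇒0≤j-i

0<-gap : ∀ {i j} → i < j → + 0 < j - i
0<-gap {i} {j} i<j = subst (_< j - i) (ℤ.+-inverseʳ i) (ℤ.+-monoˡ-< (- i) i<j)

≤-by : ∀ {i j k} → + 0 ≤ k → j - i ≡ k → i ≤ j
≤-by 0≤k j-i≡k = ℤ.0≤i-j⇒j≤i (subst (+ 0 ≤_) (sym j-i≡k) 0≤k)

<-by : ∀ {i j k} → + 0 < k → j - i ≡ k → i < j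
<-by {i} {j} 0<k j-i≡k = subst₂ _<_ (ℤ.+-identityˡ i) j-i+i≡j (ℤ.+-monoˡ-< i (subst (+ 0 <_) (sym j-i≡k) 0<k))
  where
  j-i+i≡j : j - i + i ≡ j
  j-i+i≡j = solve (i ∷ j ∷ [])

≤-from-squares : ∀ {i j} → + 0 ≤ j → i * i ≤ j * j → i ≤ j
≤-from-squares {i} {j} 0≤j i²≤j² with i ℤ.≤? j
... | yes i≤j = i≤j
... | no  i≰j = ⊥-elim (ℤ.<⇒≱ j²<i² i²≤j²)
  where
  j<i : j < i
  j<i = ℤ.≰⇒> i≰j
  j²<i² : j * j < i * i
  j²<i² = <-by (0<-* (0<-gap j<i) (ℤ.+-mono-<-≤ (ℤ.≤-<-trans 0≤j j<i) 0≤j)) (solve (i ∷ j ∷ []))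

<-from-squares : ∀ {i j} → + 0 ≤ j → i * i < j * j → i < j
<-from-squares {i} {j} 0≤j i²<j² with i ℤ.<? j
... | yes i<j = i<j
... | no  i≮j = ⊥-elim (ℤ.≤⇒≯ j²≤i² i²<j²)
  where
  j≤i : j ≤ i
  j≤i = ℤ.≮⇒≥ i≮j
  j²≤i² : j * j ≤ i * i
  j²≤i² = ≤-by (0≤-* (0≤-gap j≤i) (ℤ.+-mono-≤ (ℤ.≤-trans 0≤j j≤i) 0≤j)) (solve (i ∷ j ∷ []))

half-< : ∀ {i j k l} → + 2 * i ≡ k → + 2 * j ≡ l → k < l → i < j
half-< refl refl = ℤ.*-cancelˡ-<-nonNeg (+ 2)

half-≤ : ∀ {i j k l} → + 2 * i ≡ k → + 2 * j ≡ l → k ≤ l → i ≤ j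
half-≤ {i} {j} refl refl = ℤ.*-cancelˡ-≤-pos i j (+ 2)

2v<Ev+Fu : ∀ {E F u v} → + 2 ≤ E → + 0 ≤ v → + 0 < F → + 0 < u → + 2 * v < E * v + F * u
2v<Ev+Fu {E} {F} {u} {v} 2≤E 0≤v 0<F 0<u =
  <-by (0<-+ (0≤-* (0≤-gap 2≤E) 0≤v) (0<-* 0<F 0<u)) (solve (E ∷ F ∷ u ∷ v ∷ []))

∣-neg : ∀ {n} i → + n ∣ℤ i → + n ∣ℤ - i
∣-neg {n} i = subst (n ∣ℕ_) (sym (ℤ.∣-i∣≡∣i∣ i))

∣-neg⁻¹ : ∀ {n} i → + n ∣ℤ - i → + n ∣ℤ i
∣-neg⁻¹ {n} i = subst (n ∣ℕ_) (ℤ.∣-i∣≡∣i∣ i)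

0<i<j⇒j∤i : ∀ {i j} → + 0 < i → i < j → ¬ (j ∣ℤ i)
0<i<j⇒j∤i {+ suc a} {+ b} _ (+<+ a<b) b∣a = ℕ.<⇒≱ a<b (ℕD.∣⇒≤ b∣a)
0<i<j⇒j∤i {+ zero} (+<+ ())

-- The conic u² − d v² = 4

record NormOne (d u v : ℤ) : Set where
  constructor normOne
  field equation : u * u ≡ d * v * v + + 4

open NormOne using (equation)

0≤dv² : ∀ {d} → + 0 ≤ d → ∀ v → + 0 ≤ d * v * v
0≤dv² {d} 0≤d v = subst (+ 0 ≤_) (sym (ℤ.*-assoc d v v)) (0≤-* 0≤d (0≤-sq v))

module _ {d u v : ℤ} where

  normOne-dv² : NormOne d u v → d * v * v ≡ u * u - + 4
  normOne-dv² uv = begin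
    d * v * v               ≡⟨ solve (d ∷ v ∷ []) ⟩
    d * v * v + + 4 - + 4   ≡⟨ cong (_- + 4) (equation uv) ⟨
    u * u - + 4             ∎

  normOne-2≤ : + 0 ≤ d → NormOne d u v → + 0 < u → + 2 ≤ u
  normOne-2≤ 0≤d uv 0<u = ≤-from-squares (ℤ.<⇒≤ 0<u) (≤-by (0≤dv² 0≤d v) (begin
    u * u - + 4             ≡⟨ cong (_- + 4) (equation uv) ⟩
    d * v * v + + 4 - + 4   ≡⟨ solve (d ∷ v ∷ []) ⟩
    d * v * v               ∎))

  normOne-≢0 : + 0 ≤ d → NormOne d u v → u ≢ + 0
  normOne-≢0 0≤d uv refl = ℤ.<⇒≢ (0<-+ (0≤dv² 0≤d v) (0<+ 3)) (equation uv)

normOne-v≡0 : ∀ {d u} → + 0 ≤ d → NormOne d u (+ 0) → + 0 < u → u ≡ + 2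
normOne-v≡0 {d} {u} 0≤d uv 0<u = ℤ.≤-antisym u≤2 (normOne-2≤ 0≤d uv 0<u)
  where
  u≤2 : u ≤ + 2
  u≤2 = ≤-from-squares (0≤+ 2) (ℤ.≤-reflexive (trans (equation uv) (solve (d ∷ []))))

normOne-sq-diff : ∀ {d u v E F} → NormOne d u v → NormOne d E F → E * E - u * u ≡ d * ((F - v) * (F + v))
normOne-sq-diff {d} {u} {v} {E} {F} uv EF = begin
  E * E - u * u                           ≡⟨ cong₂ _-_ (equation EF) (equation uv) ⟩
  (d * F * F + + 4) - (d * v * v + + 4)   ≡⟨ solve (d ∷ v ∷ F ∷ []) ⟩
  d * ((F - v) * (F + v))                 ∎

normOne-gt-one : ∀ {D u v} → NormOne (+ D) u v → PosUV D (u - + 2) (v - + 0) → + 0 < u × + 0 < v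
normOne-gt-one {D} {u} {v} uv u>2∨v>0 = cases (subst (PosUV D (u - + 2)) (ℤ.+-identityʳ v) u>2∨v>0)
  where
  cases : PosUV D (u - + 2) v → + 0 < u × + 0 < v
  cases (inj₁ (0≤u-2 , 0≤v , 0<u-2⊎0<v)) = 0<u , [ 0<v , id ]′ 0<u-2⊎0<v
    where
    0<u : + 0 < u
    0<u = ℤ.<-≤-trans (0<+ 1) (ℤ.0≤i-j⇒j≤i 0≤u-2)
    0<v : + 0 < u - + 2 → + 0 < v
    0<v 0<u-2 with ℤ.<-cmp (+ 0) v
    ... | tri< 0<v _ _  = 0<v
    ... | tri≈ _ refl _ = ⊥-elim (ℤ.<-irrefl (sym (cong (_- + 2) (normOne-v≡0 (0≤+ D) uv 0<u))) 0<u-2)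
    ... | tri> _ _ v<0  = ⊥-elim (ℤ.<⇒≱ v<0 0≤v)
  cases (inj₂ (inj₁ (0<u-2 , _ , Dv²<[u-2]²))) = ⊥-elim (ℤ.<-asym Dv²<[u-2]² [u-2]²<Dv²)
    where
    [u-2]²<Dv² : (u - + 2) * (u - + 2) < + D * v * v
    [u-2]²<Dv² = <-by (0<-* (0<+ 3) (0<-gap 0<u-2)) (begin
      + D * v * v - (u - + 2) * (u - + 2)   ≡⟨ cong (_- (u - + 2) * (u - + 2)) (normOne-dv² uv) ⟩
      u * u - + 4 - (u - + 2) * (u - + 2)   ≡⟨ solve (u ∷ []) ⟩
      + 4 * (u - + 2 - + 0)                  ∎)
  cases (inj₂ (inj₂ (u-2<0 , _ , [u-2]²<Dv²))) = ⊥-elim (ℤ.<-asym [u-2]²<Dv² Dv²<[u-2]²)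
    where
    Dv²<[u-2]² : + D * v * v < (u - + 2) * (u - + 2)
    Dv²<[u-2]² = <-by (0<-* (0<+ 3) (0<-gap u-2<0)) (begin
      (u - + 2) * (u - + 2) - + D * v * v   ≡⟨ cong (λ t → (u - + 2) * (u - + 2) - t) (normOne-dv² uv) ⟩
      (u - + 2) * (u - + 2) - (u * u - + 4) ≡⟨ solve (u ∷ []) ⟩
      + 4 * (+ 0 - (u - + 2))                ∎)

normOne-ge : ∀ {D u v E F} → NormOne (+ D) u v → NormOne (+ D) E F → + 0 ≤ v → + 0 ≤ E →
             PosUV D (u - E) (v - F) → F ≤ v
normOne-ge _ _ _ _ (inj₁ (_ , 0≤v-F , _)) = ℤ.0≤i-j⇒j≤i 0≤v-F
normOne-ge {v = v} {F = F} _ _ _ _ (inj₂ (inj₂ (_ , 0<v-F , _))) = ℤ.<⇒≤ (<-by {F} {v} 0<v-F refl)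
normOne-ge {D} {u} {v} {E} {F} uv EF 0≤v 0≤E (inj₂ (inj₁ (0<u-E , v-F<0 , _))) =
  ⊥-elim (ℤ.<⇒≱ (<-by {E} {u} 0<u-E refl) u≤E)
  where
  v≤F : v ≤ F
  v≤F = ℤ.<⇒≤ (<-by (0<-gap v-F<0) (solve (v ∷ F ∷ [])))
  u≤E : u ≤ E
  u≤E = ≤-from-squares 0≤E (≤-by (0≤-* (0≤+ D) (0≤-* (0≤-gap v≤F) (0≤-+ (ℤ.≤-trans 0≤v v≤F) 0≤v)))
                                 (normOne-sq-diff uv EF))

-- Dividing (u + v√d)/2 by (E + F√d)/2, i.e. multiplying by (E − F√d)/2, gives the point whose
-- doubled coordinates are u E − d v F and v E − u F.

module _ {d u v E F : ℤ} (uv : NormOne d u v) (EF : NormOne d E F) where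

  normOne-quotient-tr : + 0 ≤ d → + 0 ≤ u → + 0 ≤ E → + 0 < u * E + d * v * (- F)
  normOne-quotient-tr 0≤d 0≤u 0≤E = <-by (0<-gap dvF<uE) (solve (d ∷ u ∷ v ∷ E ∷ F ∷ []))
    where
    0<cert : + 0 < + 4 * (d * v * v) + + 4 * (d * F * F) + + 16
    0<cert = 0<-+ (0≤-+ (0≤-* (0≤+ 4) (0≤dv² 0≤d v)) (0≤-* (0≤+ 4) (0≤dv² 0≤d F))) (0<+ 15)
    dvF<uE : d * v * F < u * E
    dvF<uE = <-from-squares (0≤-* 0≤u 0≤E) (<-by 0<cert (begin
      (u * E) * (u * E) - (d * v * F) * (d * v * F)
        ≡⟨ solve (d ∷ u ∷ v ∷ E ∷ F ∷ []) ⟩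
      (u * u) * (E * E) - (d * v * v) * (d * F * F)
        ≡⟨ cong₂ (λ p q → p * q - (d * v * v) * (d * F * F)) (equation uv) (equation EF) ⟩
      (d * v * v + + 4) * (d * F * F + + 4) - (d * v * v) * (d * F * F)
        ≡⟨ solve (d ∷ v ∷ F ∷ []) ⟩
      + 4 * (d * v * v) + + 4 * (d * F * F) + + 16
        ∎))

  normOne-quotient-coeff-nonneg : + 0 ≤ F → F ≤ v → + 0 ≤ E → + 0 ≤ u * (- F) + v * E
  normOne-quotient-coeff-nonneg 0≤F F≤v 0≤E = ≤-by (0≤-gap uF≤vE) (solve (u ∷ v ∷ E ∷ F ∷ []))
    where
    0≤v : + 0 ≤ v
    0≤v = ℤ.≤-trans 0≤F F≤v
    uF≤vE : u * F ≤ v * E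
    uF≤vE = ≤-from-squares (0≤-* 0≤v 0≤E) (≤-by (0≤-* (0≤+ 4) (0≤-* (0≤-gap F≤v) (0≤-+ 0≤v 0≤F))) (begin
      (v * E) * (v * E) - (u * F) * (u * F)
        ≡⟨ solve (u ∷ v ∷ E ∷ F ∷ []) ⟩
      (v * v) * (E * E) - (u * u) * (F * F)
        ≡⟨ cong₂ (λ p q → (v * v) * p - q * (F * F)) (equation EF) (equation uv) ⟩
      (v * v) * (d * F * F + + 4) - (d * v * v + + 4) * (F * F)
        ≡⟨ solve (d ∷ v ∷ F ∷ []) ⟩
      + 4 * ((v - F) * (v + F))
        ∎))

  normOne-quotient-coeff-< : + 0 ≤ u → + 2 ≤ E → + 0 < F → u * (- F) + v * E < + 2 * v
  normOne-quotient-coeff-< 0≤u 2≤E 0<F = <-by (0<-gap v[E-2]<uF) (solve (u ∷ v ∷ E ∷ F ∷ []))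
    where
    0<cert : + 0 < + 4 * ((v * v) * (E - + 2)) + + 4 * (F * F)
    0<cert = 0<-+ (0≤-* (0≤+ 4) (0≤-* (0≤-sq v) (0≤-gap 2≤E))) (0<-* (0<+ 3) (0<-* 0<F 0<F))
    v[E-2]<uF : v * (E - + 2) < u * F
    v[E-2]<uF = <-from-squares (0≤-* 0≤u (ℤ.<⇒≤ 0<F)) (<-by 0<cert (begin
      (u * F) * (u * F) - (v * (E - + 2)) * (v * (E - + 2))
        ≡⟨ solve (u ∷ v ∷ E ∷ F ∷ []) ⟩
      (u * u) * (F * F) - (v * v) * (E * E) + + 4 * (v * v) * (E - + 1)
        ≡⟨ cong₂ (λ p q → p * (F * F) - (v * v) * q + + 4 * (v * v) * (E - + 1)) (equation uv) (equation EF) ⟩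
      (d * v * v + + 4) * (F * F) - (v * v) * (d * F * F + + 4) + + 4 * (v * v) * (E - + 1)
        ≡⟨ solve (d ∷ v ∷ E ∷ F ∷ []) ⟩
      + 4 * ((v * v) * (E - + 2)) + + 4 * (F * F)
        ∎))

-- Arithmetic of O_K

module _ (D : ℕ) where

  mul-assoc : ∀ x y z → mul D x (mul D y z) ≡ mul D (mul D x y) z
  mul-assoc (a , b) (c , e) (g , h) = cong₂ _,_ (ω⁰ a b c e g h (Cst D) (+ D)) (ω¹ a b c e g h (Cst D) (+ D))
    where
    ω⁰ : ∀ a b c e g h C d →
      a * (c * g - e * h * C) - b * (c * h + e * g + e * h * d) * C
        ≡ (a * c - b * e * C) * g - (a * e + b * c + b * e * d) * h * C
    ω⁰ = solve-∀
    ω¹ : ∀ a b c e g h C d →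
      a * (c * h + e * g + e * h * d) + b * (c * g - e * h * C) + b * (c * h + e * g + e * h * d) * d
        ≡ (a * c - b * e * C) * h + (a * e + b * c + b * e * d) * g + (a * e + b * c + b * e * d) * h * d
    ω¹ = solve-∀

  mul-comm : ∀ x y → mul D x y ≡ mul D y x
  mul-comm (a , b) (c , e) = cong₂ _,_ (ω⁰ a b c e (Cst D)) (ω¹ a b c e (+ D))
    where
    ω⁰ : ∀ a b c e C → a * c - b * e * C ≡ c * a - e * b * C
    ω⁰ = solve-∀
    ω¹ : ∀ a b c e d → a * e + b * c + b * e * d ≡ c * b + e * a + e * b * d
    ω¹ = solve-∀

  mul-identityʳ : ∀ x → mul D x one ≡ x
  mul-identityʳ (a , b) = cong₂ _,_ (ω⁰ a b (Cst D)) (ω¹ a b (+ D))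
    where
    ω⁰ : ∀ a b C → a * + 1 - b * + 0 * C ≡ a
    ω⁰ = solve-∀
    ω¹ : ∀ a b d → a * + 0 + b * + 1 + b * + 0 * d ≡ b
    ω¹ = solve-∀

  mul-identityˡ : ∀ x → mul D one x ≡ x
  mul-identityˡ x = trans (mul-comm one x) (mul-identityʳ x)

  conj-mul : ∀ x y → conj D (mul D x y) ≡ mul D (conj D x) (conj D y)
  conj-mul (a , b) (c , e) = cong₂ _,_ (ω⁰ a b c e (Cst D) (+ D)) (ω¹ a b c e (+ D))
    where
    ω⁰ : ∀ a b c e C d → (a * c - b * e * C) + (a * e + b * c + b * e * d) * d
                         ≡ (a + b * d) * (c + e * d) - (- b) * (- e) * C
    ω⁰ = solve-∀
    ω¹ : ∀ a b c e d → - (a * e + b * c + b * e * d)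
                       ≡ (a + b * d) * (- e) + (- b) * (c + e * d) + (- b) * (- e) * d
    ω¹ = solve-∀

  conj-involutive : ∀ x → conj D (conj D x) ≡ x
  conj-involutive (a , b) = cong₂ _,_ (ω⁰ a b (+ D)) (ℤ.neg-involutive b)
    where
    ω⁰ : ∀ a b d → a + b * d + (- b) * d ≡ a
    ω⁰ = solve-∀

  neg-involutive : ∀ x → neg (neg x) ≡ x
  neg-involutive (a , b) = cong₂ _,_ (ℤ.neg-involutive a) (ℤ.neg-involutive b)

  mul-conj : ∀ x → mul D x (conj D x) ≡ (Nm D x , + 0)
  mul-conj (a , b) = cong₂ _,_ (ω⁰ a b (Cst D) (+ D)) (ω¹ a b (+ D))
    where
    ω⁰ : ∀ a b C d → a * (a + b * d) - b * (- b) * C ≡ a * a + a * b * d + b * b * C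
    ω⁰ = solve-∀
    ω¹ : ∀ a b d → a * (- b) + b * (a + b * d) + b * (- b) * d ≡ + 0
    ω¹ = solve-∀

  Nm-mul : ∀ x y → Nm D (mul D x y) ≡ Nm D x * Nm D y
  Nm-mul (a , b) (c , e) = identity a b c e (Cst D) (+ D)
    where
    identity : ∀ a b c e C d →
      (a * c - b * e * C) * (a * c - b * e * C) + (a * c - b * e * C) * (a * e + b * c + b * e * d) * d
        + (a * e + b * c + b * e * d) * (a * e + b * c + b * e * d) * C
      ≡ (a * a + a * b * d + b * b * C) * (c * c + c * e * d + e * e * C)
    identity = solve-∀

  Nm-conj : ∀ x → Nm D (conj D x) ≡ Nm D x
  Nm-conj (a , b) = identity a b (Cst D) (+ D)
    where
    identity : ∀ a b C d → (a + b * d) * (a + b * d) + (a + b * d) * (- b) * d + (- b) * (- b) * C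
                           ≡ a * a + a * b * d + b * b * C
    identity = solve-∀

  Nm-neg : ∀ x → Nm D (neg x) ≡ Nm D x
  Nm-neg (a , b) = identity a b (Cst D) (+ D)
    where
    identity : ∀ a b C d → (- a) * (- a) + (- a) * (- b) * d + (- b) * (- b) * C
                           ≡ a * a + a * b * d + b * b * C
    identity = solve-∀

  pow-+ : ∀ x m n → pow D x (m ℕ.+ n) ≡ mul D (pow D x m) (pow D x n)
  pow-+ x zero    n = sym (mul-identityˡ (pow D x n))
  pow-+ x (suc m) n = trans (cong (mul D x) (pow-+ x m n)) (mul-assoc x (pow D x m) (pow D x n))

  pow-* : ∀ x q m → pow D x (q ℕ.* m) ≡ pow D (pow D x m) q
  pow-* x zero    m = refl
  pow-* x (suc q) m = trans (pow-+ x m (q ℕ.* m)) (cong (mul D (pow D x m)) (pow-* x q m))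

  conj-pow : ∀ x n → conj D (pow D x n) ≡ pow D (conj D x) n
  conj-pow x zero    = refl
  conj-pow x (suc n) = trans (conj-mul x (pow D x n)) (cong (mul D (conj D x)) (conj-pow x n))

  conj-pow≡zpow-neg : ∀ x n → conj D (pow D x n) ≡ zpow D x (- + n)
  conj-pow≡zpow-neg x zero    = refl
  conj-pow≡zpow-neg x (suc n) = conj-pow x (suc n)

  module _ (x : Elt) (Nm-x : Nm D x ≡ + 1) where

    mul-conj-norm-one : mul D x (conj D x) ≡ one
    mul-conj-norm-one = trans (mul-conj x) (cong (_, + 0) Nm-x)

    Nm-pow : ∀ n → Nm D (pow D x n) ≡ + 1
    Nm-pow zero    = refl
    Nm-pow (suc n) = trans (Nm-mul x (pow D x n)) (cong₂ _*_ Nm-x (Nm-pow n))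

    Nm-zpow : ∀ n → Nm D (zpow D x n) ≡ + 1
    Nm-zpow (+ n)    = Nm-pow n
    Nm-zpow -[1+ n ] = trans (cong (Nm D) (sym (conj-pow x (suc n)))) (trans (Nm-conj (pow D x (suc n))) (Nm-pow (suc n)))

    conj-cancelʳ : ∀ y → mul D (mul D y x) (conj D x) ≡ y
    conj-cancelʳ y = begin
      mul D (mul D y x) (conj D x)   ≡⟨ mul-assoc y x (conj D x) ⟨
      mul D y (mul D x (conj D x))   ≡⟨ cong (mul D y) mul-conj-norm-one ⟩
      mul D y one                    ≡⟨ mul-identityʳ y ⟩
      y                              ∎

    conj-cancelˡ : ∀ y → mul D x (mul D y (conj D x)) ≡ y
    conj-cancelˡ y = begin
      mul D x (mul D y (conj D x))   ≡⟨ mul-assoc x y (conj D x) ⟩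
      mul D (mul D x y) (conj D x)   ≡⟨ cong (λ z → mul D z (conj D x)) (mul-comm x y) ⟩
      mul D (mul D y x) (conj D x)   ≡⟨ conj-cancelʳ y ⟩
      y                              ∎

  pow-+-cancel : ∀ x → Nm D x ≡ + 1 → ∀ r s → mul D (pow D x (r ℕ.+ s)) (conj D (pow D x s)) ≡ pow D x r
  pow-+-cancel x Nm-x r s =
    trans (cong (λ y → mul D y (conj D (pow D x s))) (pow-+ x r s)) (conj-cancelʳ (pow D x s) (Nm-pow x Nm-x s) (pow D x r))

-- The orders O_f and j_min

module _ (D : ℕ) (f : ℕ) where

  ∈O-mul : ∀ x y → InOrder f x → InOrder f y → InOrder f (mul D x y)
  ∈O-mul (a , b) (c , e) f∣b f∣e =
    ∣⇒∣ᵤ {+ f} (∣m∣n⇒∣m+n (∣m∣n⇒∣m+n (∣n⇒∣m*n a f∣ₛe) (∣m⇒∣m*n c f∣ₛb)) (∣m⇒∣m*n (+ D) (∣m⇒∣m*n e f∣ₛb)))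
    where
    f∣ₛb = ∣ᵤ⇒∣ {+ f} {b} f∣b
    f∣ₛe = ∣ᵤ⇒∣ {+ f} {e} f∣e

  ∈O-pow : ∀ x n → InOrder f x → InOrder f (pow D x n)
  ∈O-pow x zero    _   = f ∣0
  ∈O-pow x (suc n) f∣x = ∈O-mul x (pow D x n) f∣x (∈O-pow x n f∣x)

  ∈O-zpow : ∀ x n → InOrder f x → InOrder f (zpow D x n)
  ∈O-zpow x (+ n)    f∣x = ∈O-pow x n f∣x
  ∈O-zpow x -[1+ n ] f∣x = ∈O-pow (conj D x) (suc n) (∣-neg (proj₂ x) f∣x)

IsJmin-unique : ∀ {D x f m m′} → IsJmin D x f m → IsJmin D x f m′ → m ≡ m′
IsJmin-unique (1≤m , f∣fm , m-least) (1≤m′ , f∣fm′ , m′-least) = ℕ.≤-antisym (m-least _ 1≤m′ f∣fm′) (m′-least _ 1≤m f∣fm)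

±Power : ℕ → Elt → Elt → Set
±Power D x w = Σ ℤ λ n → w ≡ zpow D x n ⊎ w ≡ neg (zpow D x n)

module _ (D : ℕ) (x : Elt) (Nm-x : Nm D x ≡ + 1) {f m : ℕ} (jmin : IsJmin D x f m) where

  private
    instance
      m≢0 : ℕ.NonZero m
      m≢0 = ℕ.>-nonZero {m} (proj₁ jmin)
    f∣fm : InOrder f (pow D x m)
    f∣fm = proj₁ (proj₂ jmin)

  ∈O-pow-jmin : ∀ q → InOrder f (pow D x (q ℕ.* m))
  ∈O-pow-jmin q = subst (InOrder f) (sym (pow-* D x q m)) (∈O-pow D f (pow D x m) q f∣fm)

  jmin∣⇒∣fj : ∀ {j} → m ∣ℕ j → + f ∣ℤ fj D x j
  jmin∣⇒∣fj (divides q refl) = ∈O-pow-jmin q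

  -- x^(j mod m) = x^j · conj (x^(qm)) lies in O_f, so the minimality of m forces j mod m = 0.
  ∣fj⇒jmin∣ : ∀ j → + f ∣ℤ fj D x j → m ∣ℕ j
  ∣fj⇒jmin∣ j f∣fj = m%n≡0⇒n∣m j m (below-jmin (m%n<n j m) f∣fj[j%m])
    where
    q r : ℕ
    q = j / m
    r = j % m
    f∣fj[r+qm] : InOrder f (pow D x (r ℕ.+ q ℕ.* m))
    f∣fj[r+qm] = subst (InOrder f) (cong (pow D x) (m≡m%n+[m/n]*n j m)) f∣fj
    f∣fj[j%m] : InOrder f (pow D x r)
    f∣fj[j%m] = subst (InOrder f) (pow-+-cancel D x Nm-x r (q ℕ.* m))
      (∈O-mul D f (pow D x (r ℕ.+ q ℕ.* m)) (conj D (pow D x (q ℕ.* m))) f∣fj[r+qm] (∣-neg (proj₂ (pow D x (q ℕ.* m))) (∈O-pow-jmin q)))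
    below-jmin : ∀ {r} → r ℕ.< m → InOrder f (pow D x r) → r ≡ 0
    below-jmin {zero}  _   _      = refl
    below-jmin {suc r} r<m f∣fjr = ⊥-elim (ℕ.<⇒≱ r<m (proj₂ (proj₂ jmin) (suc r) (s≤s z≤n) f∣fjr))

  pow-∈O⇒pow-jmin : ∀ j → InOrder f (pow D x j) → Σ ℕ λ q → pow D x j ≡ pow D (pow D x m) q
  pow-∈O⇒pow-jmin j f∣fj = q , trans (cong (pow D x) j≡q*m) (pow-* D x q m)
    where
    open ℕD._∣_ (∣fj⇒jmin∣ j f∣fj) renaming (quotient to q; equality to j≡q*m)

  zpow-∈O⇒zpow-jmin : ∀ n → InOrder f (zpow D x n) → Σ ℤ λ n′ → zpow D x n ≡ zpow D (pow D x m) n′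
  zpow-∈O⇒zpow-jmin (+ j) f∣xʲ = map +_ id (pow-∈O⇒pow-jmin j f∣xʲ)
  zpow-∈O⇒zpow-jmin -[1+ j ] f∣x⁻ʲ = map (λ q → - + q) x⁻ʲ≡ (pow-∈O⇒pow-jmin (suc j) f∣xʲ)
    where
    f∣xʲ : InOrder f (pow D x (suc j))
    f∣xʲ = ∣-neg⁻¹ (proj₂ (pow D x (suc j))) (subst (InOrder f) (sym (conj-pow D x (suc j))) f∣x⁻ʲ)
    x⁻ʲ≡ : ∀ {q} → pow D x (suc j) ≡ pow D (pow D x m) q → pow D (conj D x) (suc j) ≡ zpow D (pow D x m) (- + q)
    x⁻ʲ≡ {q} xʲ≡ = begin
      pow D (conj D x) (suc j)     ≡⟨ conj-pow D x (suc j) ⟨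
      conj D (pow D x (suc j))     ≡⟨ cong (conj D) xʲ≡ ⟩
      conj D (pow D (pow D x m) q) ≡⟨ conj-pow≡zpow-neg D (pow D x m) q ⟩
      zpow D (pow D x m) (- + q)   ∎

  ±power-jmin⇒∈O : ∀ w → ±Power D (pow D x m) w → InOrder f w × Nm D w ≡ + 1
  ±power-jmin⇒∈O _ (n , inj₁ refl) = ∈O-zpow D f (pow D x m) n f∣fm , Nm-zpow D (pow D x m) (Nm-pow D x Nm-x m) n
  ±power-jmin⇒∈O _ (n , inj₂ refl) =
      ∣-neg (proj₂ (zpow D (pow D x m) n)) (∈O-zpow D f (pow D x m) n f∣fm)
    , trans (Nm-neg D (zpow D (pow D x m) n)) (Nm-zpow D (pow D x m) (Nm-pow D x Nm-x m) n)

-- Cst truncates (Δ₀² − Δ₀)/4, which is exact because Δ₀ ≡ 0, 1 (mod 4).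

4∣D²-D : ∀ {D} → FundDisc D → 4 ∣ℕ D ℕ.* D ∸ D
4∣D²-D {D} fd = subst (4 ∣ℕ_) (D*[D∸1]≡D²-D) (4∣D*[D∸1] fd)
  where
  D*[D∸1]≡D²-D : D ℕ.* (D ∸ 1) ≡ D ℕ.* D ∸ D
  D*[D∸1]≡D²-D = trans (ℕ.*-distribˡ-∸ D D 1) (cong (D ℕ.* D ∸_) (ℕ.*-identityʳ D))
  4∣D*[D∸1] : FundDisc D → 4 ∣ℕ D ℕ.* (D ∸ 1)
  4∣D*[D∸1] (inj₁ (D%4≡1 , _)) = ℕD.∣n⇒∣m*n D (divides (D / 4) (cong (_∸ 1) (trans (m≡m%n+[m/n]*n D 4) (cong (ℕ._+ (D / 4) ℕ.* 4) D%4≡1))))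
  4∣D*[D∸1] (inj₂ (m , refl , _)) = ℕD.∣m⇒∣m*n (4 ℕ.* m ∸ 1) (divides m (ℕ.*-comm 4 m))

four-Cst : ∀ {D} → FundDisc D → + 4 * Cst D ≡ + D * + D - + D
four-Cst {D} fd = begin
  + 4 * + ((D ℕ.* D ∸ D) / 4)   ≡⟨ ℤ.pos-* 4 ((D ℕ.* D ∸ D) / 4) ⟨
  + (4 ℕ.* ((D ℕ.* D ∸ D) / 4)) ≡⟨ cong +_ (m*[n/m]≡n (4∣D²-D fd)) ⟩
  + (D ℕ.* D ∸ D)               ≡⟨ pos-n²∸n D ⟩
  + D * + D - + D               ∎
  where
  pos-n²∸n : ∀ n → + (n ℕ.* n ∸ n) ≡ + n * + n - + n
  pos-n²∸n zero      = refl
  pos-n²∸n n@(suc _) = begin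
    + (n ℕ.* n ∸ n)   ≡⟨ ℤ.⊖-≥ (ℕ.m≤m*n n n) ⟨
    n ℕ.* n ⊖ n       ≡⟨ ℤ.m-n≡m⊖n (n ℕ.* n) n ⟨
    + (n ℕ.* n) - + n ≡⟨ cong (_- + n) (ℤ.pos-* n n) ⟩
    + n * + n - + n   ∎

tr : ℕ → Elt → ℤ
tr D (a , b) = + 2 * a + b * + D

module _ (D : ℕ) where

  tr-sub : ∀ x y → tr D (sub x y) ≡ tr D x - tr D y
  tr-sub (a , b) (c , e) = identity a b c e (+ D)
    where
    identity : ∀ a b c e d → + 2 * (a - c) + (b - e) * d ≡ (+ 2 * a + b * d) - (+ 2 * c + e * d)
    identity = solve-∀

  Gt⇒PosUV : ∀ x y → Gt D x y → PosUV D (tr D x - tr D y) (proj₂ x - proj₂ y)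
  Gt⇒PosUV x y = subst (λ t → PosUV D t (proj₂ x - proj₂ y)) (tr-sub x y)

  PosUV⇒Gt : ∀ x y → PosUV D (tr D x - tr D y) (proj₂ x - proj₂ y) → Gt D x y
  PosUV⇒Gt x y = subst (λ t → PosUV D t (proj₂ x - proj₂ y)) (sym (tr-sub x y))

  tr-conj : ∀ x → tr D (conj D x) ≡ tr D x
  tr-conj (a , b) = identity a b (+ D)
    where
    identity : ∀ a b d → + 2 * (a + b * d) + (- b) * d ≡ + 2 * a + b * d
    identity = solve-∀

  tr-neg : ∀ x → tr D (neg x) ≡ - tr D x
  tr-neg (a , b) = identity a b (+ D)
    where
    identity : ∀ a b d → + 2 * (- a) + (- b) * d ≡ - (+ 2 * a + b * d)
    identity = solve-∀

  coords-injective : ∀ x y → tr D x ≡ tr D y → proj₂ x ≡ proj₂ y → x ≡ y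
  coords-injective (a , b) (c , .b) tr≡ refl = cong (_, b) (ℤ.*-cancelˡ-≡ (+ 2) a c (begin
    + 2 * a                  ≡⟨ identity a b (+ D) ⟩
    tr D (a , b) - b * + D   ≡⟨ cong (_- b * + D) tr≡ ⟩
    tr D (c , b) - b * + D   ≡⟨ identity c b (+ D) ⟨
    + 2 * c                  ∎))
    where
    identity : ∀ a b d → + 2 * a ≡ (+ 2 * a + b * d) - b * d
    identity = solve-∀

  coeff-mul : ∀ x y → + 2 * proj₂ (mul D x y) ≡ tr D x * proj₂ y + proj₂ x * tr D y
  coeff-mul (a , b) (c , e) = identity a b c e (+ D)
    where
    identity : ∀ a b c e d → + 2 * (a * e + b * c + b * e * d) ≡ (+ 2 * a + b * d) * e + b * (+ 2 * c + e * d)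
    identity = solve-∀

module _ {D : ℕ} (four-Cst : + 4 * Cst D ≡ + D * + D - + D) where

  tr-mul : ∀ x y → + 2 * tr D (mul D x y) ≡ tr D x * tr D y + + D * proj₂ x * proj₂ y
  tr-mul (a , b) (c , e) = begin
    + 2 * (+ 2 * (a * c - b * e * C) + (a * e + b * c + b * e * d) * d)
      ≡⟨ isolate-C a b c e C d ⟩
    + 2 * (+ 2 * (a * c) + (a * e + b * c + b * e * d) * d) - b * e * (+ 4 * C)
      ≡⟨ cong (λ t → + 2 * (+ 2 * (a * c) + (a * e + b * c + b * e * d) * d) - b * e * t) four-Cst ⟩
    + 2 * (+ 2 * (a * c) + (a * e + b * c + b * e * d) * d) - b * e * (d * d - d)
      ≡⟨ regroup a b c e d ⟩
    (+ 2 * a + b * d) * (+ 2 * c + e * d) + d * b * e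
      ∎
    where
    C d : ℤ
    C = Cst D
    d = + D
    isolate-C : ∀ a b c e C d → + 2 * (+ 2 * (a * c - b * e * C) + (a * e + b * c + b * e * d) * d)
                         ≡ + 2 * (+ 2 * (a * c) + (a * e + b * c + b * e * d) * d) - b * e * (+ 4 * C)
    isolate-C = solve-∀
    regroup : ∀ a b c e d → + 2 * (+ 2 * (a * c) + (a * e + b * c + b * e * d) * d) - b * e * (d * d - d)
                       ≡ (+ 2 * a + b * d) * (+ 2 * c + e * d) + d * b * e
    regroup = solve-∀

  Nm-coords : ∀ x → + 4 * Nm D x ≡ tr D x * tr D x - + D * proj₂ x * proj₂ x
  Nm-coords (a , b) = begin
    + 4 * (a * a + a * b * d + b * b * C)           ≡⟨ isolate-C a b C d ⟩
    + 4 * (a * a + a * b * d) + b * b * (+ 4 * C)   ≡⟨ cong (λ t → + 4 * (a * a + a * b * d) + b * b * t) four-Cst ⟩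
    + 4 * (a * a + a * b * d) + b * b * (d * d - d) ≡⟨ regroup a b d ⟩
    (+ 2 * a + b * d) * (+ 2 * a + b * d) - d * b * b ∎
    where
    C d : ℤ
    C = Cst D
    d = + D
    isolate-C : ∀ a b C d → + 4 * (a * a + a * b * d + b * b * C) ≡ + 4 * (a * a + a * b * d) + b * b * (+ 4 * C)
    isolate-C = solve-∀
    regroup : ∀ a b d → + 4 * (a * a + a * b * d) + b * b * (d * d - d) ≡ (+ 2 * a + b * d) * (+ 2 * a + b * d) - d * b * b
    regroup = solve-∀

  normOne-coords : ∀ x → Nm D x ≡ + 1 → NormOne (+ D) (tr D x) (proj₂ x)
  normOne-coords x Nm-x = normOne (begin
    u * u                                ≡⟨ identity (u * u) (+ D * v * v) ⟩
    (u * u - + D * v * v) + + D * v * v  ≡⟨ cong (_+ + D * v * v) (Nm-coords x) ⟨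
    + 4 * Nm D x + + D * v * v           ≡⟨ cong (λ n → + 4 * n + + D * v * v) Nm-x ⟩
    + 4 + + D * v * v                    ≡⟨ ℤ.+-comm (+ 4) (+ D * v * v) ⟩
    + D * v * v + + 4                    ∎)
    where
    u v : ℤ
    u = tr D x
    v = proj₂ x
    identity : ∀ p q → p ≡ (p - q) + q
    identity = solve-∀

-- The fundamental unit

module FundamentalUnit {D : ℕ} (four-Cst : + 4 * Cst D ≡ + D * + D - + D) {ε : Elt} (fund : IsFundUnit D ε) where

  private
    Nm-ε : Nm D ε ≡ + 1
    Nm-ε = proj₁ fund
    E F : ℤ
    E = tr D ε
    F = proj₂ ε
    ε-on-conic : NormOne (+ D) E F
    ε-on-conic = normOne-coords four-Cst ε Nm-ε
    0<E×0<F : + 0 < E × + 0 < F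
    0<E×0<F = normOne-gt-one ε-on-conic (Gt⇒PosUV D ε one (proj₁ (proj₂ fund)))
    0<E : + 0 < E
    0<E = proj₁ 0<E×0<F
    0<F : + 0 < F
    0<F = proj₂ 0<E×0<F
    2≤E : + 2 ≤ E
    2≤E = normOne-2≤ (0≤+ D) ε-on-conic 0<E

  ε-coeff-minimal : ∀ u → Nm D u ≡ + 1 → + 0 < tr D u → + 0 < proj₂ u → F ≤ proj₂ u
  ε-coeff-minimal u Nm-u 0<tr 0<v = u≥ε⇒F≤v (proj₂ (proj₂ fund) u Nm-u u>1)
    where
    u-on-conic : NormOne (+ D) (tr D u) (proj₂ u)
    u-on-conic = normOne-coords four-Cst u Nm-u
    u>1 : Gt D u one
    u>1 = PosUV⇒Gt D u one (inj₁ (0≤-gap (normOne-2≤ (0≤+ D) u-on-conic 0<tr) , ℤ.<⇒≤ (0<-gap 0<v) , inj₂ (0<-gap 0<v)))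
    u≥ε⇒F≤v : Ge D u ε → F ≤ proj₂ u
    u≥ε⇒F≤v (inj₁ u>ε) = normOne-ge u-on-conic ε-on-conic (ℤ.<⇒≤ 0<v) (ℤ.<⇒≤ 0<E) (Gt⇒PosUV D u ε u>ε)
    u≥ε⇒F≤v (inj₂ u≡ε) = ℤ.≤-reflexive (cong proj₂ (sym u≡ε))

  quotient-by-ε : ∀ u → Nm D u ≡ + 1 → + 0 < tr D u → F ≤ proj₂ u →
                  let y = mul D u (conj D ε) in + 0 < tr D y × + 0 ≤ proj₂ y × proj₂ y < proj₂ u
  quotient-by-ε u Nm-u 0<tr F≤v =
      half-< refl 2tr[y] (normOne-quotient-tr u-on-conic ε-on-conic (0≤+ D) (ℤ.<⇒≤ 0<tr) (ℤ.<⇒≤ 0<E))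
    , half-≤ refl 2v[y] (normOne-quotient-coeff-nonneg u-on-conic ε-on-conic (ℤ.<⇒≤ 0<F) F≤v (ℤ.<⇒≤ 0<E))
    , half-< 2v[y] refl (normOne-quotient-coeff-< u-on-conic ε-on-conic (ℤ.<⇒≤ 0<tr) 2≤E 0<F)
    where
    u-on-conic : NormOne (+ D) (tr D u) (proj₂ u)
    u-on-conic = normOne-coords four-Cst u Nm-u
    2tr[y] : + 2 * tr D (mul D u (conj D ε)) ≡ tr D u * E + + D * proj₂ u * (- F)
    2tr[y] = trans (tr-mul four-Cst u (conj D ε)) (cong (λ t → tr D u * t + + D * proj₂ u * (- F)) (tr-conj D ε))
    2v[y] : + 2 * proj₂ (mul D u (conj D ε)) ≡ tr D u * (- F) + proj₂ u * E
    2v[y] = trans (coeff-mul D u (conj D ε)) (cong (λ t → tr D u * (- F) + proj₂ u * t) (tr-conj D ε))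

  positive-unit-is-power : ∀ u → Nm D u ≡ + 1 → + 0 < tr D u → + 0 ≤ proj₂ u → Σ ℕ λ k → u ≡ pow D ε k
  positive-unit-is-power u Nm-u 0<tr 0≤v = <-rec P descend ∣ proj₂ u ∣ u (sym (ℤ.0≤i⇒+∣i∣≡i 0≤v)) Nm-u 0<tr
    where
    P : ℕ → Set
    P n = ∀ u → proj₂ u ≡ + n → Nm D u ≡ + 1 → + 0 < tr D u → Σ ℕ λ k → u ≡ pow D ε k
    descend : ∀ n → (∀ {m} → m ℕ.< n → P m) → P n
    descend zero    _   u v≡0 Nm-u 0<tr = 0 , coords-injective D u one u₀≡2 v≡0
      where
      u₀≡2 : tr D u ≡ + 2
      u₀≡2 = normOne-v≡0 (0≤+ D) (subst (NormOne (+ D) (tr D u)) v≡0 (normOne-coords four-Cst u Nm-u)) 0<tr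
    descend (suc n) rec u v≡1+n Nm-u 0<tr =
      map suc (λ y≡εᵏ → trans (sym (conj-cancelˡ D ε Nm-ε u)) (cong (mul D ε) y≡εᵏ))
        (rec smaller y (sym v[y]≡) Nm-y 0<tr[y])
      where
      y : Elt
      y = mul D u (conj D ε)
      Nm-y : Nm D y ≡ + 1
      Nm-y = trans (Nm-mul D u (conj D ε)) (cong₂ _*_ Nm-u (trans (Nm-conj D ε) Nm-ε))
      quotient : + 0 < tr D y × + 0 ≤ proj₂ y × proj₂ y < proj₂ u
      quotient = quotient-by-ε u Nm-u 0<tr (ε-coeff-minimal u Nm-u 0<tr (subst (+ 0 <_) (sym v≡1+n) (0<+ n)))
      0<tr[y] : + 0 < tr D y
      0<tr[y] = proj₁ quotient
      v[y]≡ : + ∣ proj₂ y ∣ ≡ proj₂ y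
      v[y]≡ = ℤ.0≤i⇒+∣i∣≡i (proj₁ (proj₂ quotient))
      smaller : ∣ proj₂ y ∣ ℕ.< suc n
      smaller = ℤ.drop‿+<+ (subst₂ _<_ (sym v[y]≡) v≡1+n (proj₂ (proj₂ quotient)))

  positive-trace-unit-is-power : ∀ w → Nm D w ≡ + 1 → + 0 < tr D w → Σ ℤ λ n → w ≡ zpow D ε n
  positive-trace-unit-is-power w Nm-w 0<tr with + 0 ℤ.≤? proj₂ w
  ... | yes 0≤v = map +_ id (positive-unit-is-power w Nm-w 0<tr 0≤v)
  ... | no  0≰v = map (λ k → - + k) w≡ε⁻ᵏ (positive-unit-is-power (conj D w) Nm-w̄ 0<tr[w̄] 0≤v[w̄])
    where
    Nm-w̄ : Nm D (conj D w) ≡ + 1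
    Nm-w̄ = trans (Nm-conj D w) Nm-w
    0<tr[w̄] : + 0 < tr D (conj D w)
    0<tr[w̄] = subst (+ 0 <_) (sym (tr-conj D w)) 0<tr
    0≤v[w̄] : + 0 ≤ proj₂ (conj D w)
    0≤v[w̄] = ℤ.<⇒≤ (ℤ.neg-mono-< (ℤ.≰⇒> 0≰v))
    w≡ε⁻ᵏ : ∀ {k} → conj D w ≡ pow D ε k → w ≡ zpow D ε (- + k)
    w≡ε⁻ᵏ {k} w̄≡εᵏ = begin
      w                     ≡⟨ conj-involutive D w ⟨
      conj D (conj D w)     ≡⟨ cong (conj D) w̄≡εᵏ ⟩
      conj D (pow D ε k)    ≡⟨ conj-pow≡zpow-neg D ε k ⟩
      zpow D ε (- + k)      ∎

  unit-is-±power : ∀ w → Nm D w ≡ + 1 → ±Power D ε w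
  unit-is-±power w Nm-w with ℤ.<-cmp (+ 0) (tr D w)
  ... | tri< 0<tr _ _ = map₂ inj₁ (positive-trace-unit-is-power w Nm-w 0<tr)
  ... | tri≈ _ 0≡tr _ = ⊥-elim (normOne-≢0 (0≤+ D) (normOne-coords four-Cst w Nm-w) (sym 0≡tr))
  ... | tri> _ _ tr<0 =
    map₂ (λ -w≡εⁿ → inj₂ (trans (sym (neg-involutive D w)) (cong neg -w≡εⁿ)))
      (positive-trace-unit-is-power (neg w) (trans (Nm-neg D w) Nm-w) (subst (+ 0 <_) (sym (tr-neg D w)) (ℤ.neg-mono-< tr<0)))

  pow-ε-positive : ∀ j → + 0 < tr D (pow D ε j) × + 0 ≤ fj D ε j
  pow-ε-positive zero    = 0<+ 1 , 0≤+ 0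
  pow-ε-positive (suc j) =
      half-< refl (tr-mul four-Cst ε (pow D ε j)) (0<-+ˡ (0<-* 0<E 0<tr) (0≤-* (0≤-* (0≤+ D) (ℤ.<⇒≤ 0<F)) 0≤fj))
    , half-≤ refl (coeff-mul D ε (pow D ε j)) (0≤-+ (0≤-* (ℤ.<⇒≤ 0<E) 0≤fj) (0≤-* (ℤ.<⇒≤ 0<F) (ℤ.<⇒≤ 0<tr)))
    where
    0<tr : + 0 < tr D (pow D ε j)
    0<tr = proj₁ (pow-ε-positive j)
    0≤fj : + 0 ≤ fj D ε j
    0≤fj = proj₂ (pow-ε-positive j)

  fj-step : ∀ j → fj D ε j < fj D ε (suc j)
  fj-step j = half-< refl (coeff-mul D ε (pow D ε j))
    (2v<Ev+Fu 2≤E (proj₂ (pow-ε-positive j)) 0<F (proj₁ (pow-ε-positive j)))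

  fj-mono-< : ∀ {i k} → i ℕ.< k → fj D ε i < fj D ε k
  fj-mono-< {i} {suc k} i<1+k =
    [ (λ i<k → ℤ.<-trans (fj-mono-< i<k) (fj-step k))
    , (λ i≡k → subst (λ t → fj D ε t < fj D ε (suc k)) (sym i≡k) (fj-step k))
    ]′ (ℕ.m<1+n⇒m<n∨m≡n i<1+k)

  IsJmin-fj : ∀ k → 1 ℕ.≤ k → IsJmin D ε ∣ fj D ε k ∣ k
  IsJmin-fj k 1≤k = 1≤k , ℕD.∣-refl , k-least
    where
    k-least : ∀ i → 1 ℕ.≤ i → + ∣ fj D ε k ∣ ∣ℤ fj D ε i → k ℕ.≤ i
    k-least i 1≤i fk∣fi with k ℕ.≤? i
    ... | yes k≤i = k≤i
    ... | no  k≰i = ⊥-elim (0<i<j⇒j∤i (fj-mono-< 1≤i) (fj-mono-< (ℕ.≰⇒> k≰i)) fk∣fi)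

  ∈O⇒±power-jmin : ∀ {f m} → IsJmin D ε f m → ∀ w → InOrder f w → Nm D w ≡ + 1 → ±Power D (pow D ε m) w
  ∈O⇒±power-jmin jmin w w∈O Nm-w with unit-is-±power w Nm-w
  ... | n , inj₁ refl = map₂ inj₁ (zpow-∈O⇒zpow-jmin D ε Nm-ε jmin n w∈O)
  ... | n , inj₂ refl = map₂ (inj₂ ∘ cong neg) (zpow-∈O⇒zpow-jmin D ε Nm-ε jmin n (∣-neg⁻¹ (proj₂ (zpow D ε n)) w∈O))

theorem4p14 : (Δ₀ : ℕ) → FundDisc Δ₀ → 1 ℕ.< Δ₀ → (ε : Elt) → IsFundUnit Δ₀ ε →
    (∀ f → 1 ℕ.≤ f → ∀ m → IsJmin Δ₀ ε f m → ∀ w →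
      (InOrder f w × Nm Δ₀ w ≡ + 1)
        ⇔ Σ ℤ (λ n → w ≡ zpow Δ₀ (pow Δ₀ ε m) n ⊎ w ≡ neg (zpow Δ₀ (pow Δ₀ ε m) n)))
  × (∀ k → 1 ℕ.≤ k → ∀ m → IsJmin Δ₀ ε ∣ fj Δ₀ ε k ∣ m → m ≡ k)
  × (∀ f j → 1 ℕ.≤ f → 1 ℕ.≤ j → ∀ m → IsJmin Δ₀ ε f m →
      ((+ f ∣ℤ fj Δ₀ ε j) ⇔ (m ∣ℕ j)))
  × (∀ j k → 1 ℕ.≤ j → 1 ℕ.≤ k → ((j ∣ℕ k) ⇔ (fj Δ₀ ε j ∣ℤ fj Δ₀ ε k)))
theorem4p14 Δ₀ fd _ ε fund =
    (λ f _ m jmin w → mk⇔ (uncurry (∈O⇒±power-jmin jmin w)) (±power-jmin⇒∈O Δ₀ ε Nm-ε jmin w))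
  , (λ k 1≤k m jmin → IsJmin-unique jmin (IsJmin-fj k 1≤k))
  , (λ f j _ _ m jmin → mk⇔ (∣fj⇒jmin∣ Δ₀ ε Nm-ε jmin j) (jmin∣⇒∣fj Δ₀ ε Nm-ε jmin))
  , (λ j k 1≤j _ → mk⇔ (jmin∣⇒∣fj Δ₀ ε Nm-ε (IsJmin-fj j 1≤j)) (∣fj⇒jmin∣ Δ₀ ε Nm-ε (IsJmin-fj j 1≤j) k))
  where
  open FundamentalUnit (four-Cst fd) fund
  Nm-ε : Nm Δ₀ ε ≡ + 1
  Nm-ε = proj₁ fund
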